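{- Let $w\in\mathbf{C}^{\infty}$ have height $k>0$, and let $u$ be the minimal part of $w$. Then $w$ can be obtained from $u$ by successive extensions to the left and to the right by letters of $\Sigma$, in such a way that every intermediate word is a $\mathbf{C}^{\infty}$-word of height $k$.
   Context: Let $\Sigma=\{1,2\}$. For a word $w$ over $\Sigma$ written uniquely as $w=x_1^{i_1}\cdots x_n^{i_n}$ with $x_j\in\Sigma$, $x_j\neq x_{j+1}$, $i_j>0$, its run-length encoding is $\Delta(w)=i_1\cdots i_n$. A word is differentiable if $\Delta(w)$ is a word over $\Sigma$ (equivalently, it contains neither $111$ nor $222$). The derivative $D(w)$ of a differentiable word: $D(\epsilon)=\epsilon$, and otherwise $D(w)$ is obtained from $\Delta(w)$ by deleting its first symbol if it is $1$ and deleting its last symbol if it is $1$. $\mathbf{C}^{\infty}$ is the set of words $w$ over $\Sigma$ for which $D^j(w)$ is defined for all $j\ge0$. The height of $w\in\mathbf{C}^{\infty}$ is the least $k$ with $D^k(w)=\epsilon$. For $w$ of height $k>0$ the root is $D^{k-1}(w)\in\{1,2,12,21\}$; $w$ is single-rooted if the root has length one, double-rooted if it has length two. A primitive of $w$ is a word $w'$ with $D(w')=w$. A word $w\in\mathbf{C}^{\infty}$ of height $k>1$ is minimal if for each $0\le j\le k-2$, $D^j(w)$ is a primitive of $D^{j+1}(w)$ of minimal length among all its primitives; words of height $1$ are minimal. Every $w\in\mathbf{C}^{\infty}$ of height $k>0$ contains at least one factor that is a single-rooted minimal word of height $k$; the minimal part of $w$ is the first (leftmost occurring) such factor. -}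

module Defs where

open import Data.Nat using (ℕ; zero; suc; _≤_; _<_; _∸_)
open import Data.List using (List; []; _∷_; _++_; [_]; length)
open import Data.Maybe using (Maybe; just; nothing; _>>=_; Is-just)
open import Data.Product using (Σ; _×_)
open import Relation.Binary.PropositionalEquality using (_≡_; _≢_)

data Letter : Set where
  one two : Letter

Word : Set
Word = List Letter

runsFrom : Letter → ℕ → Word → List ℕ
runsFrom c n [] = n ∷ []
runsFrom one n (one ∷ ys) = runsFrom one (suc n) ys
runsFrom two n (two ∷ ys) = runsFrom two (suc n) ys
runsFrom one n (two ∷ ys) = n ∷ runsFrom two 1 ys
runsFrom two n (one ∷ ys) = n ∷ runsFrom one 1 ys

runs : Word → List ℕ
runs [] = []
runs (x ∷ xs) = runsFrom x 1 xs

toWord : List ℕ → Maybe Word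
toWord [] = just []
toWord (1 ∷ ns) = toWord ns >>= λ w → just (one ∷ w)
toWord (2 ∷ ns) = toWord ns >>= λ w → just (two ∷ w)
toWord (_ ∷ ns) = nothing

-- Δ(w), defined exactly when w is differentiable
Δ : Word → Maybe Word
Δ w = toWord (runs w)

dropFirstOne : Word → Word
dropFirstOne (one ∷ w) = w
dropFirstOne w = w

dropLastOne : Word → Word
dropLastOne [] = []
dropLastOne (one ∷ []) = []
dropLastOne (two ∷ []) = two ∷ []
dropLastOne (x ∷ y ∷ ys) = x ∷ dropLastOne (y ∷ ys)

D : Word → Maybe Word
D [] = just []
D w = Δ w >>= λ d → just (dropLastOne (dropFirstOne d))

Dpow : ℕ → Word → Maybe Word
Dpow zero w = just w
Dpow (suc j) w = Dpow j w >>= D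

C∞ : Word → Set
C∞ w = (j : ℕ) → Is-just (Dpow j w)

Height : Word → ℕ → Set
Height w k = C∞ w × (Dpow k w ≡ just []) × ((j : ℕ) → j < k → Dpow j w ≢ just [])

SingleRooted : Word → ℕ → Set
SingleRooted w k = Σ Letter λ a → Dpow (k ∸ 1) w ≡ just [ a ]

Minimal : Word → ℕ → Set
Minimal w k = (j : ℕ) → suc (suc j) ≤ k → (v v' : Word) →
  Dpow j w ≡ just v → Dpow (suc j) w ≡ just v' →
  (p : Word) → D p ≡ just v' → length v ≤ length p

MinimalPart : Word → ℕ → Word → Word → Word → Set
MinimalPart w k x u y =
  (w ≡ x ++ u ++ y) × Height u k × SingleRooted u k × Minimal u k ×
  ((x' u' y' : Word) → w ≡ x' ++ u' ++ y' → Height u' k → SingleRooted u' k →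
     Minimal u' k → length x ≤ length x')

data Reach (k : ℕ) : Word → Word → Set where
  done  : {v : Word} → Reach k v v
  left  : {v w : Word} (a : Letter) → Height (a ∷ v) k → Reach k (a ∷ v) w → Reach k v w
  right : {v w : Word} (a : Letter) → Height (v ++ [ a ]) k → Reach k (v ++ [ a ]) w → Reach k v w

module Submission where

-- The key fact is that derivation respects factors: if
-- w is differentiable and v ⊑ w, then v is differentiable and D(v) ⊑ D(w).
-- It suffices to check this when v arises from w by deleting one letter at
-- either end, which comes down to how the run-length encoding changes.
-- Iterating, D^j(v) ⊑ D^j(w) for all j, so every z with u ⊑ z ⊑ w is in C^∞
-- and has height exactly k: D^k(z) sits inside D^k(w) = ε, while D^j(z) = ε
-- for some j < k would force D^j(u) = ε.  Finally w = x u y is reached from u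
-- by prepending the letters of x and then appending those of y one at a time;
-- every intermediate word lies between u and w, hence has height k.

open import Defs
open import Data.Nat using (ℕ; zero; suc; _<_)
open import Data.List using (List; []; _∷_; _++_; [_])
open import Data.List.Properties using (++-assoc; ++-identityʳ; ++-conicalˡ; ++-conicalʳ)
open import Data.Maybe using (Maybe; just; nothing; _>>=_; Is-just)
open import Data.Maybe.Relation.Unary.Any using (just)
open import Data.Product using (Σ; _×_; _,_)
open import Data.Sum using (_⊎_; inj₁; inj₂)
open import Data.Unit using (tt)
open import Relation.Binary.PropositionalEquality
  using (_≡_; _≢_; refl; sym; trans; cong; subst; module ≡-Reasoning)

infix 4 _⊑_
_⊑_ : Word → Word → Set
v ⊑ w = Σ Word λ x → Σ Word λ y → w ≡ x ++ v ++ y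

⊑-refl : ∀ v → v ⊑ v
⊑-refl v = [] , [] , sym (++-identityʳ v)

⊑-trans : ∀ {u v w} → u ⊑ v → v ⊑ w → u ⊑ w
⊑-trans {u} (x₁ , y₁ , refl) (x₂ , y₂ , refl) = x₂ ++ x₁ , y₁ ++ y₂ , regroup
  where
  open ≡-Reasoning
  regroup : x₂ ++ (x₁ ++ u ++ y₁) ++ y₂ ≡ (x₂ ++ x₁) ++ u ++ (y₁ ++ y₂)
  regroup = begin
    x₂ ++ (x₁ ++ u ++ y₁) ++ y₂   ≡⟨ cong (x₂ ++_) (++-assoc x₁ (u ++ y₁) y₂) ⟩
    x₂ ++ x₁ ++ (u ++ y₁) ++ y₂   ≡⟨ cong (λ t → x₂ ++ x₁ ++ t) (++-assoc u y₁ y₂) ⟩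
    x₂ ++ x₁ ++ u ++ y₁ ++ y₂     ≡⟨ sym (++-assoc x₂ x₁ (u ++ y₁ ++ y₂)) ⟩
    (x₂ ++ x₁) ++ u ++ y₁ ++ y₂   ∎

ε⊑ : ∀ w → [] ⊑ w
ε⊑ w = [] , w , refl

prefix⊑ : ∀ v y → v ⊑ v ++ y
prefix⊑ v y = [] , y , refl

suffix⊑ : ∀ x v → v ⊑ x ++ v
suffix⊑ x v = x , [] , cong (x ++_) (sym (++-identityʳ v))

⊑ε⇒ε : ∀ {v} → v ⊑ [] → v ≡ []
⊑ε⇒ε {v} (x , y , e) = ++-conicalˡ v y (++-conicalʳ x (v ++ y) (sym e))

code : Letter → ℕ
code one = 1
code two = 2

toWord-∷⁻ : ∀ n ns {d} → toWord (n ∷ ns) ≡ just d →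
  Σ Letter λ b → Σ Word λ e → code b ≡ n × toWord ns ≡ just e × d ≡ b ∷ e
toWord-∷⁻ 0 ns ()
toWord-∷⁻ 1 ns eq with toWord ns
toWord-∷⁻ 1 ns refl | just e = one , e , refl , refl , refl
toWord-∷⁻ 1 ns ()   | nothing
toWord-∷⁻ 2 ns eq with toWord ns
toWord-∷⁻ 2 ns refl | just e = two , e , refl , refl , refl
toWord-∷⁻ 2 ns ()   | nothing
toWord-∷⁻ (suc (suc (suc n))) ns ()

toWord-∷ : ∀ b {ns e} → toWord ns ≡ just e → toWord (code b ∷ ns) ≡ just (b ∷ e)
toWord-∷ one eq rewrite eq = refl
toWord-∷ two eq rewrite eq = refl

toWord-++ : ∀ ps {qs e f} → toWord ps ≡ just e → toWord qs ≡ just f →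
  toWord (ps ++ qs) ≡ just (e ++ f)
toWord-++ [] refl tq = tq
toWord-++ (p ∷ ps) tp tq with toWord-∷⁻ p ps tp
... | b , e , refl , te , refl = toWord-∷ b (toWord-++ ps te tq)

toWord-++⁻ : ∀ ps {qs d} → toWord (ps ++ qs) ≡ just d →
  Σ Word λ e → Σ Word λ f → toWord ps ≡ just e × toWord qs ≡ just f × d ≡ e ++ f
toWord-++⁻ [] td = [] , _ , refl , td , refl
toWord-++⁻ (p ∷ ps) td with toWord-∷⁻ p (ps ++ _) td
... | b , e , refl , te , refl with toWord-++⁻ ps te
... | e₁ , f , t₁ , t₂ , refl = b ∷ e₁ , f , toWord-∷ b t₁ , t₂ , refl

flipL : Letter → Letter
flipL one = two
flipL two = one

lastL : Letter → Word → Letter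
lastL c [] = c
lastL c (x ∷ xs) = lastL x xs

letterCase : ∀ a l → a ≡ l ⊎ a ≡ flipL l
letterCase one one = inj₁ refl
letterCase one two = inj₂ refl
letterCase two one = inj₂ refl
letterCase two two = inj₁ refl

incHead : List ℕ → List ℕ
incHead [] = []
incHead (m ∷ ms) = suc m ∷ ms

runsFrom-suc : ∀ c n xs → runsFrom c (suc n) xs ≡ incHead (runsFrom c n xs)
runsFrom-suc c n [] = refl
runsFrom-suc one n (one ∷ xs) = runsFrom-suc one (suc n) xs
runsFrom-suc one n (two ∷ xs) = refl
runsFrom-suc two n (one ∷ xs) = refl
runsFrom-suc two n (two ∷ xs) = runsFrom-suc two (suc n) xs

runsFrom-nonempty : ∀ c n xs → Σ ℕ λ h → Σ (List ℕ) λ t → runsFrom c n xs ≡ h ∷ t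
runsFrom-nonempty c n [] = n , [] , refl
runsFrom-nonempty one n (one ∷ xs) = runsFrom-nonempty one (suc n) xs
runsFrom-nonempty one n (two ∷ xs) = n , _ , refl
runsFrom-nonempty two n (one ∷ xs) = n , _ , refl
runsFrom-nonempty two n (two ∷ xs) = runsFrom-nonempty two (suc n) xs

runsFrom-repeat : ∀ c n xs → runsFrom c n (c ∷ xs) ≡ runsFrom c (suc n) xs
runsFrom-repeat one n xs = refl
runsFrom-repeat two n xs = refl

runs-∷-same : ∀ a xs → Σ ℕ λ h → Σ (List ℕ) λ t →
  runs (a ∷ xs) ≡ suc h ∷ t × runs (a ∷ a ∷ xs) ≡ suc (suc h) ∷ t
runs-∷-same a xs with runsFrom-nonempty a 0 xs
... | h , t , e =
  h , t , runs₁ , trans (runsFrom-repeat a 1 xs) (trans (runsFrom-suc a 1 xs) (cong incHead runs₁))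
  where
  runs₁ : runsFrom a 1 xs ≡ suc h ∷ t
  runs₁ = trans (runsFrom-suc a 0 xs) (cong incHead e)

runs-∷-flip : ∀ a xs → runs (a ∷ flipL a ∷ xs) ≡ 1 ∷ runs (flipL a ∷ xs)
runs-∷-flip one xs = refl
runs-∷-flip two xs = refl

runsFrom-snoc-same : ∀ c n xs → Σ (List ℕ) λ ps → Σ ℕ λ m →
  runsFrom c (suc n) xs ≡ ps ++ [ suc m ] ×
  runsFrom c (suc n) (xs ++ [ lastL c xs ]) ≡ ps ++ [ suc (suc m) ]
runsFrom-snoc-same one n [] = [] , n , refl , refl
runsFrom-snoc-same two n [] = [] , n , refl , refl
runsFrom-snoc-same one n (one ∷ xs) = runsFrom-snoc-same one (suc n) xs
runsFrom-snoc-same two n (two ∷ xs) = runsFrom-snoc-same two (suc n) xs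
runsFrom-snoc-same one n (two ∷ xs) with runsFrom-snoc-same two 0 xs
... | ps , m , e₁ , e₂ = suc n ∷ ps , m , cong (suc n ∷_) e₁ , cong (suc n ∷_) e₂
runsFrom-snoc-same two n (one ∷ xs) with runsFrom-snoc-same one 0 xs
... | ps , m , e₁ , e₂ = suc n ∷ ps , m , cong (suc n ∷_) e₁ , cong (suc n ∷_) e₂

runsFrom-snoc-flip : ∀ c n xs →
  runsFrom c n (xs ++ [ flipL (lastL c xs) ]) ≡ runsFrom c n xs ++ [ 1 ]
runsFrom-snoc-flip one n [] = refl
runsFrom-snoc-flip two n [] = refl
runsFrom-snoc-flip one n (one ∷ xs) = runsFrom-snoc-flip one (suc n) xs
runsFrom-snoc-flip two n (two ∷ xs) = runsFrom-snoc-flip two (suc n) xs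
runsFrom-snoc-flip one n (two ∷ xs) = cong (n ∷_) (runsFrom-snoc-flip two 1 xs)
runsFrom-snoc-flip two n (one ∷ xs) = cong (n ∷_) (runsFrom-snoc-flip one 1 xs)

Δ-∷-same : ∀ a xs {d} → Δ (a ∷ a ∷ xs) ≡ just d →
  Σ Word λ e → d ≡ two ∷ e × Δ (a ∷ xs) ≡ just (one ∷ e)
Δ-∷-same a xs td with runs-∷-same a xs
... | h , t , r₁ , r₂ with toWord-∷⁻ (suc (suc h)) t (trans (cong toWord (sym r₂)) td)
... | one , _ , () , _ , _
... | two , e , refl , te , refl = e , refl , trans (cong toWord r₁) (toWord-∷ one {t} te)

Δ-∷-flip : ∀ a xs {d} → Δ (a ∷ flipL a ∷ xs) ≡ just d →
  Σ Word λ e → d ≡ one ∷ e × Δ (flipL a ∷ xs) ≡ just e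
Δ-∷-flip a xs td
  with toWord-∷⁻ 1 (runs (flipL a ∷ xs)) (trans (cong toWord (sym (runs-∷-flip a xs))) td)
... | one , e , refl , te , refl = e , refl , te

Δ-snoc-same : ∀ b xs {d} → Δ (b ∷ xs ++ [ lastL b xs ]) ≡ just d →
  Σ Word λ e → d ≡ e ++ [ two ] × Δ (b ∷ xs) ≡ just (e ++ [ one ])
Δ-snoc-same b xs td with runsFrom-snoc-same b 0 xs
... | ps , m , r₁ , r₂ with toWord-++⁻ ps (trans (cong toWord (sym r₂)) td)
... | e , f , te , tf , refl with toWord-∷⁻ (suc (suc m)) [] tf
... | one , _ , () , _ , _
... | two , .[] , refl , refl , refl =
  e , refl , trans (cong toWord r₁) (toWord-++ ps te refl)

Δ-snoc-flip : ∀ b xs {d} → Δ (b ∷ xs ++ [ flipL (lastL b xs) ]) ≡ just d →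
  Σ Word λ e → d ≡ e ++ [ one ] × Δ (b ∷ xs) ≡ just e
Δ-snoc-flip b xs td
  with toWord-++⁻ (runsFrom b 1 xs) (trans (cong toWord (sym (runsFrom-snoc-flip b 1 xs))) td)
... | e , .(one ∷ []) , te , refl , refl = e , refl , te

trim : Word → Word
trim d = dropLastOne (dropFirstOne d)

D-∷ : ∀ b v {d} → Δ (b ∷ v) ≡ just d → D (b ∷ v) ≡ just (trim d)
D-∷ b v eq = cong (_>>= λ d → just (trim d)) eq

D-∷⁻ : ∀ b v {w'} → D (b ∷ v) ≡ just w' → Σ Word λ d → Δ (b ∷ v) ≡ just d × w' ≡ trim d
D-∷⁻ b v eq with Δ (b ∷ v)
D-∷⁻ b v refl | just d = d , refl , refl
D-∷⁻ b v ()   | nothing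

dropLastOne-∷ : ∀ x e → dropLastOne e ⊑ dropLastOne (x ∷ e)
dropLastOne-∷ x [] = ε⊑ _
dropLastOne-∷ one (y ∷ t) = suffix⊑ [ one ] (dropLastOne (y ∷ t))
dropLastOne-∷ two (y ∷ t) = suffix⊑ [ two ] (dropLastOne (y ∷ t))

dropLastOne-snoc : ∀ s a → dropLastOne (s ++ [ a ]) ≡ s ++ dropLastOne [ a ]
dropLastOne-snoc [] a = refl
dropLastOne-snoc (one ∷ []) a = refl
dropLastOne-snoc (two ∷ []) a = refl
dropLastOne-snoc (one ∷ y ∷ t) a = cong (one ∷_) (dropLastOne-snoc (y ∷ t) a)
dropLastOne-snoc (two ∷ y ∷ t) a = cong (two ∷_) (dropLastOne-snoc (y ∷ t) a)

dropLastOne-split : ∀ s → Σ Word λ r → s ≡ dropLastOne s ++ r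
dropLastOne-split [] = [] , refl
dropLastOne-split (one ∷ []) = one ∷ [] , refl
dropLastOne-split (two ∷ []) = [] , refl
dropLastOne-split (one ∷ y ∷ t) with dropLastOne-split (y ∷ t)
... | r , e = r , cong (one ∷_) e
dropLastOne-split (two ∷ y ∷ t) with dropLastOne-split (y ∷ t)
... | r , e = r , cong (two ∷_) e

dropLastOne-prefix : ∀ s → dropLastOne s ⊑ s
dropLastOne-prefix s with dropLastOne-split s
... | r , e = [] , r , e

dropFirstOne-++ : ∀ x e t → dropFirstOne (x ∷ e ++ t) ≡ dropFirstOne (x ∷ e) ++ t
dropFirstOne-++ one e t = refl
dropFirstOne-++ two e t = refl

trim-∷-one : ∀ e → trim e ⊑ trim (one ∷ e)
trim-∷-one [] = ⊑-refl _
trim-∷-one (one ∷ e) = dropLastOne-∷ one e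
trim-∷-one (two ∷ e) = ⊑-refl _

trim-∷-two : ∀ e → trim (one ∷ e) ⊑ trim (two ∷ e)
trim-∷-two e = dropLastOne-∷ two e

trim-snoc-one : ∀ e → trim e ⊑ trim (e ++ [ one ])
trim-snoc-one [] = ε⊑ _
trim-snoc-one (x ∷ e)
  rewrite dropFirstOne-++ x e [ one ]
        | dropLastOne-snoc (dropFirstOne (x ∷ e)) one
        | ++-identityʳ (dropFirstOne (x ∷ e)) = dropLastOne-prefix _

trim-snoc-two : ∀ e → trim (e ++ [ one ]) ⊑ trim (e ++ [ two ])
trim-snoc-two [] = ε⊑ _
trim-snoc-two (x ∷ e)
  rewrite dropFirstOne-++ x e [ one ] | dropFirstOne-++ x e [ two ]
        | dropLastOne-snoc (dropFirstOne (x ∷ e)) one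
        | dropLastOne-snoc (dropFirstOne (x ∷ e)) two
        | ++-identityʳ (dropFirstOne (x ∷ e)) = prefix⊑ _ _

infix 4 _◃_
record _◃_ (v w : Word) : Set where
  field derivative : ∀ {w'} → D w ≡ just w' → Σ Word λ v' → D v ≡ just v' × v' ⊑ w'
open _◃_

◃-trans : ∀ {u v w} → u ◃ v → v ◃ w → u ◃ w
derivative (◃-trans uv vw) Dw with derivative vw Dw
... | v' , Dv , v'⊑w' with derivative uv Dv
... | u' , Du , u'⊑v' = u' , Du , ⊑-trans u'⊑v' v'⊑w'

◃-refl : ∀ v → v ◃ v
derivative (◃-refl v) {v'} Dv = v' , Dv , ⊑-refl v'

◃-ε : ∀ w → [] ◃ w
derivative (◃-ε w) _ = [] , refl , ε⊑ _

◃-∷-same : ∀ a xs → a ∷ xs ◃ a ∷ a ∷ xs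
derivative (◃-∷-same a xs) Dw with D-∷⁻ a (a ∷ xs) Dw
... | _ , td , refl with Δ-∷-same a xs td
... | e , refl , te = trim (one ∷ e) , D-∷ a xs te , trim-∷-two e

◃-∷-flip : ∀ a xs → flipL a ∷ xs ◃ a ∷ flipL a ∷ xs
derivative (◃-∷-flip a xs) Dw with D-∷⁻ a (flipL a ∷ xs) Dw
... | _ , td , refl with Δ-∷-flip a xs td
... | e , refl , te = trim e , D-∷ (flipL a) xs te , trim-∷-one e

◃-∷ : ∀ a v → v ◃ a ∷ v
◃-∷ a [] = ◃-ε _
◃-∷ one (one ∷ xs) = ◃-∷-same one xs
◃-∷ two (two ∷ xs) = ◃-∷-same two xs
◃-∷ one (two ∷ xs) = ◃-∷-flip one xs
◃-∷ two (one ∷ xs) = ◃-∷-flip two xs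

◃-snoc-same : ∀ b xs → b ∷ xs ◃ b ∷ xs ++ [ lastL b xs ]
derivative (◃-snoc-same b xs) Dw with D-∷⁻ b (xs ++ [ lastL b xs ]) Dw
... | _ , td , refl with Δ-snoc-same b xs td
... | e , refl , te = trim (e ++ [ one ]) , D-∷ b xs te , trim-snoc-two e

◃-snoc-flip : ∀ b xs → b ∷ xs ◃ b ∷ xs ++ [ flipL (lastL b xs) ]
derivative (◃-snoc-flip b xs) Dw with D-∷⁻ b (xs ++ [ flipL (lastL b xs) ]) Dw
... | _ , td , refl with Δ-snoc-flip b xs td
... | e , refl , te = trim e , D-∷ b xs te , trim-snoc-one e

◃-snoc : ∀ a v → v ◃ v ++ [ a ]
◃-snoc a [] = ◃-ε _
◃-snoc a (b ∷ xs) with letterCase a (lastL b xs)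
... | inj₁ refl = ◃-snoc-same b xs
... | inj₂ refl = ◃-snoc-flip b xs

◃-prefix : ∀ v y → v ◃ v ++ y
◃-prefix v [] = subst (v ◃_) (sym (++-identityʳ v)) (◃-refl v)
◃-prefix v (a ∷ y) =
  ◃-trans (◃-snoc a v) (subst (v ++ [ a ] ◃_) (++-assoc v [ a ] y) (◃-prefix (v ++ [ a ]) y))

◃-suffix : ∀ x v → v ◃ x ++ v
◃-suffix [] v = ◃-refl v
◃-suffix (a ∷ x) v = ◃-trans (◃-suffix x v) (◃-∷ a (x ++ v))

⊑⇒◃ : ∀ {v w} → v ⊑ w → v ◃ w
⊑⇒◃ {v} (x , y , refl) = ◃-trans (◃-prefix v y) (◃-suffix x (v ++ y))

Is-just⇒just : ∀ {m : Maybe Word} → Is-just m → Σ Word λ x → m ≡ just x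
Is-just⇒just (just {x = x} _) = x , refl

just⇒Is-just : ∀ {m : Maybe Word} {x} → m ≡ just x → Is-just m
just⇒Is-just refl = just tt

Dpow-⊑ : ∀ j {v w} → v ⊑ w → C∞ w →
  Σ Word λ wⱼ → Σ Word λ vⱼ → Dpow j w ≡ just wⱼ × Dpow j v ≡ just vⱼ × vⱼ ⊑ wⱼ
Dpow-⊑ zero {v} {w} v⊑w _ = w , v , refl , refl , v⊑w
Dpow-⊑ (suc j) v⊑w c∞ with Dpow-⊑ j v⊑w c∞
... | wⱼ , vⱼ , ew , ev , vⱼ⊑wⱼ with Is-just⇒just (c∞ (suc j))
... | w' , ew' with derivative (⊑⇒◃ vⱼ⊑wⱼ) (trans (cong (_>>= D) (sym ew)) ew')
... | v' , Dv , v'⊑w' = w' , v' , ew' , trans (cong (_>>= D) ev) Dv , v'⊑w'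

height-between : ∀ {u z w k} → u ⊑ z → z ⊑ w → Height u k → Height w k → Height z k
height-between {u} {z} {w} {k} u⊑z z⊑w (_ , _ , u≢ε) (c∞w , wₖ≡ε , _) = c∞z , zₖ≡ε , z≢ε
  where
  c∞z : C∞ z
  c∞z j with Dpow-⊑ j z⊑w c∞w
  ... | _ , _ , _ , ez , _ = just⇒Is-just ez

  zₖ≡ε : Dpow k z ≡ just []
  zₖ≡ε with Dpow-⊑ k z⊑w c∞w
  ... | wₖ , zₖ , ew , ez , zₖ⊑wₖ with trans (sym ew) wₖ≡ε
  ... | refl = trans ez (cong just (⊑ε⇒ε zₖ⊑wₖ))

  z≢ε : (j : ℕ) → j < k → Dpow j z ≢ just []
  z≢ε j j<k zⱼ≡ε with Dpow-⊑ j u⊑z c∞z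
  ... | zⱼ , uⱼ , ez , eu , uⱼ⊑zⱼ with trans (sym ez) zⱼ≡ε
  ... | refl = u≢ε j j<k (trans eu (cong just (⊑ε⇒ε uⱼ⊑zⱼ)))

Reach-trans : ∀ {k u v w} → Reach k u v → Reach k v w → Reach k u w
Reach-trans done r = r
Reach-trans (left a h r) r' = left a h (Reach-trans r r')
Reach-trans (right a h r) r' = right a h (Reach-trans r r')

extend-right : ∀ {k} v y → (∀ z → v ⊑ z → z ⊑ v ++ y → Height z k) → Reach k v (v ++ y)
extend-right {k} v [] _ = subst (Reach k v) (sym (++-identityʳ v)) done
extend-right {k} v (a ∷ y) between =
  right a (between (v ++ [ a ]) v⊑va (subst (v ++ [ a ] ⊑_) regroup (prefix⊑ (v ++ [ a ]) y)))
    (subst (Reach k (v ++ [ a ])) regroup (extend-right (v ++ [ a ]) y between′))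
  where
  regroup : (v ++ [ a ]) ++ y ≡ v ++ a ∷ y
  regroup = ++-assoc v [ a ] y
  v⊑va : v ⊑ v ++ [ a ]
  v⊑va = prefix⊑ v [ a ]
  between′ : ∀ z → v ++ [ a ] ⊑ z → z ⊑ (v ++ [ a ]) ++ y → Height z k
  between′ z va⊑z z⊑vay = between z (⊑-trans v⊑va va⊑z) (subst (z ⊑_) regroup z⊑vay)

extend-left : ∀ {k} x v → (∀ z → v ⊑ z → z ⊑ x ++ v → Height z k) → Reach k v (x ++ v)
extend-left [] v _ = done
extend-left {k} (a ∷ x) v between =
  Reach-trans (extend-left x v between′)
    (left a (between (a ∷ x ++ v) (suffix⊑ (a ∷ x) v) (⊑-refl _)) done)
  where
  between′ : ∀ z → v ⊑ z → z ⊑ x ++ v → Height z k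
  between′ z v⊑z z⊑xv = between z v⊑z (⊑-trans z⊑xv (suffix⊑ [ a ] (x ++ v)))

corollary1 : (w : Word) (k : ℕ) → 0 < k → Height w k →
    (x u y : Word) → MinimalPart w k x u y → Reach k u w
corollary1 w k _ hw x u y (refl , hu , _) =
  subst (Reach k u) (++-assoc x u y)
    (Reach-trans (extend-left x u λ z u⊑z z⊑xu → between z u⊑z (⊑-trans z⊑xu xu⊑w))
                 (extend-right (x ++ u) y λ z xu⊑z z⊑xuy →
                    between z (⊑-trans (suffix⊑ x u) xu⊑z) (subst (z ⊑_) (++-assoc x u y) z⊑xuy)))
  where
  between : ∀ z → u ⊑ z → z ⊑ x ++ u ++ y → Height z k
  between z u⊑z z⊑w = height-between u⊑z z⊑w hu hw
  xu⊑w : x ++ u ⊑ x ++ u ++ y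
  xu⊑w = subst (x ++ u ⊑_) (++-assoc x u y) (prefix⊑ (x ++ u) y)
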